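{- Let $G$ be a finite, connected, undirected multigraph without loops with $n$ vertices, reduced Laplacian $\tilde L$, and $m=|\mathrm{Jac}(G)|$. For $D_1,D_2\in\mathrm{Div}^0(G)$ let $\tilde w_i=m\tilde L^{ -1}\tilde D_i\in\mathbb{Z}^{n-1}$. Then $\tilde w_1\equiv\tilde w_2\pmod m$ (entrywise) if and only if $D_1\sim D_2$.
   Context: Vertices are indexed $v_1,\dots,v_n$. A divisor is a vector in $\mathbb{Z}^n$; $\mathrm{Div}^0(G)$ is the group of divisors with entry sum $0$; $\tilde D$ is $D$ with its $n$-th entry deleted. The Laplacian is $L=\Delta-A$ ($\Delta$ diagonal of valencies, $A_{ij}$ the number of edges between $v_i,v_j$); $\tilde L$ is $L$ with the $n$-th row and column deleted, with $\det\tilde L=m$, so $m\tilde L^{ -1}$ is an integer matrix. $D_1\sim D_2$ means $D_1-D_2=L\sigma$ for some $\sigma\in\mathbb{Z}^n$, and $\mathrm{Jac}(G)=\mathrm{Div}^0(G)/\sim$. -}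

module Defs where

open import Data.Nat using (ℕ; zero; suc)
open import Data.Fin using (Fin; zero; suc; fromℕ; inject₁; punchIn; toℕ; _≟_)
open import Data.Integer using (ℤ; +_; _+_; _*_; _-_; -_; 0ℤ; 1ℤ)
open import Data.Integer.Divisibility using (_∣_)
open import Data.Product using (Σ; ∃; _×_; _,_)
open import Data.Empty using (⊥)
open import Data.List using (List; []; _∷_)
open import Relation.Nullary using (yes; no)
open import Relation.Binary.PropositionalEquality using (_≡_)

Σ[_] : ∀ {k} → (Fin k → ℤ) → ℤ
Σ[_] {zero} f = 0ℤ
Σ[_] {suc k} f = f zero + Σ[ (λ i → f (suc i)) ]

Σℕ : ∀ {k} → (Fin k → ℕ) → ℕ
Σℕ {zero} f = 0
Σℕ {suc k} f = f zero Data.Nat.+ Σℕ (λ i → f (suc i))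

sgn : ℕ → ℤ
sgn zero = 1ℤ
sgn (suc t) = - sgn t

Matrix : ℕ → Set
Matrix k = Fin k → Fin k → ℤ

minor : ∀ {k} → Matrix (suc k) → Fin (suc k) → Fin (suc k) → Matrix k
minor M i j r c = M (punchIn i r) (punchIn j c)

det : ∀ {k} → Matrix k → ℤ
det {zero} M = 1ℤ
det {suc k} M = Σ[ (λ j → sgn (toℕ j) * (M zero j * det (minor M zero j))) ]

adj : ∀ {k} → Matrix k → Matrix k
adj {zero} M ()
adj {suc k} M i j = sgn (toℕ i Data.Nat.+ toℕ j) * det (minor M j i)

_·_ : ∀ {k} → Matrix k → (Fin k → ℤ) → (Fin k → ℤ)
(M · v) i = Σ[ (λ j → M i j * v j) ]

-- Multigraphs on vertices v_1..v_n (here Fin n), given by the edge-count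
-- matrix A (A i j = number of edges between v_i and v_j).

record Multigraph (n : ℕ) : Set where
  field
    A         : Fin n → Fin n → ℕ
    symmetric : ∀ i j → A i j ≡ A j i
    loopless  : ∀ i → A i i ≡ 0

open Multigraph public

data Walk {n} (G : Multigraph n) : Fin n → Fin n → Set where
  here : ∀ {i} → Walk G i i
  step : ∀ {i j k} → (A G i j ≡ 0 → ⊥) → Walk G j k → Walk G i k

Connected : ∀ {n} → Multigraph n → Set
Connected G = ∀ i j → Walk G i j

valency : ∀ {n} → Multigraph n → Fin n → ℕ
valency G i = Σℕ (λ j → A G i j)

laplacian : ∀ {n} → Multigraph n → Matrix n
laplacian G i j with i ≟ j
... | yes _ = + valency G i - + A G i j
... | no  _ = - (+ A G i j)

-- reduced Laplacian: delete the n-th row and column (n = suc k, last index fromℕ k)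
reducedLaplacian : ∀ {k} → Multigraph (suc k) → Matrix k
reducedLaplacian G r c = laplacian G (inject₁ r) (inject₁ c)

Divisor : ℕ → Set
Divisor n = Fin n → ℤ

InDiv0 : ∀ {n} → Divisor n → Set
InDiv0 D = Σ[ D ] ≡ 0ℤ

reduce : ∀ {k} → Divisor (suc k) → (Fin k → ℤ)
reduce D r = D (inject₁ r)

_∼[_]_ : ∀ {n} → Divisor n → Multigraph n → Divisor n → Set
D₁ ∼[ G ] D₂ = ∃ λ (σ : Fin _ → ℤ) → ∀ i → D₁ i - D₂ i ≡ (laplacian G · σ) i

-- m = det L̃ (= |Jac(G)| by Kirchhoff)
jacOrder : ∀ {k} → Multigraph (suc k) → ℤ
jacOrder G = det (reducedLaplacian G)

-- w̃ = m L̃⁻¹ D̃ = adj(L̃) D̃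
wTilde : ∀ {k} → Multigraph (suc k) → Divisor (suc k) → (Fin k → ℤ)
wTilde G D = adj (reducedLaplacian G) · reduce D

_≡_[mod_] : ∀ {k} → (Fin k → ℤ) → (Fin k → ℤ) → ℤ → Set
v ≡ w [mod m ] = ∀ i → m ∣ (v i - w i)

module Submission where

-- Write L̃ for the reduced Laplacian, m = det L̃ and d = D̃₁ − D̃₂, so that w̃₁ − w̃₂ = adj(L̃) d.
-- Since 2σᵀLσ = Σᵢⱼ Aᵢⱼ (σᵢ − σⱼ)², on a connected graph L̃ is positive definite (a vector killed
-- by the form is constant, and it vanishes at the deleted vertex). Hence m > 0, L̃ is injective and
-- L̃ adj(L̃) = adj(L̃) L̃ = m·I, so m divides adj(L̃) d entrywise iff d = L̃ u for an integral u.
-- Finally, for degree-zero divisors, D₁ − D₂ = Lσ iff d = L̃ u: normalise σ to vanish at the last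
-- vertex, whose entry is then fixed by the degree.

open import Defs
import Data.Integer.Properties as ℤP
open import Algebra.Bundles using (AbelianGroup)
open import Algebra.Properties.CommutativeSemigroup ℤP.*-commutativeSemigroup using (x∙yz≈y∙xz)
open import Algebra.Properties.Group (AbelianGroup.group ℤP.+-0-abelianGroup)
  using () renaming (∙-cancelˡ to +-cancelˡ)
open import Algebra.Properties.Ring ℤP.+-*-ring using (x[y-z]≈xy-xz)
open import Algebra.Properties.Semiring.Sum ℤP.+-*-semiring
  using (sum; sum-cong-≗; ∑-distrib-+; ∑-comm; sum-remove; sum-init-last; *-distribˡ-sum; *-distribʳ-sum)
open import Data.Empty using (⊥-elim)
open import Data.Fin using (Fin; zero; suc; fromℕ; inject₁; punchIn; punchOut; toℕ; _≟_)
open import Data.Fin.Induction using (<-weakInduction)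
open import Data.Fin.Properties using (punchInᵢ≢i; punchIn-punchOut; toℕ-inject₁)
open import Data.Integer as ℤ using (ℤ; +_; _+_; _*_; _-_; -_; 0ℤ; 1ℤ; +[1+_]; -[1+_]; _≤_; _<_)
open import Data.Integer.Divisibility using (_∣_)
import Data.Integer.Divisibility.Signed as Signed
open import Data.Integer.Tactic.RingSolver using (solve-∀)
open import Data.Nat as ℕ using (ℕ; zero; suc)
import Data.Nat.Properties as ℕP
open import Data.Product using (∃; _,_)
open import Data.Sum using (_⊎_; inj₁; inj₂)
open import Data.Vec.Functional using (_∷_; insertAt; updateAt)
open import Data.Vec.Functional.Properties
  using (insertAt-lookup; insertAt-punchIn; updateAt-updates; updateAt-minimal; updateAt-id-local)
open import Function using (_∘_; flip; const)
open import Function.Bundles using (_⇔_; mk⇔)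
open import Relation.Binary.PropositionalEquality
open import Relation.Nullary using (yes; no)

Σ≡sum : ∀ {k} (f : Fin k → ℤ) → Σ[ f ] ≡ sum f
Σ≡sum {zero}  f = refl
Σ≡sum {suc k} f = cong (_+_ (f zero)) (Σ≡sum (f ∘ suc))

Σ²≡sum² : ∀ {k l} (f : Fin k → Fin l → ℤ) → Σ[ (λ i → Σ[ f i ]) ] ≡ sum (λ i → sum (f i))
Σ²≡sum² f = trans (Σ≡sum (λ i → Σ[ f i ])) (sum-cong-≗ (λ i → Σ≡sum (f i)))

Σ-cong : ∀ {k} {f g : Fin k → ℤ} → f ≗ g → Σ[ f ] ≡ Σ[ g ]
Σ-cong {zero}  f≗g = refl
Σ-cong {suc k} f≗g = cong₂ _+_ (f≗g zero) (Σ-cong (f≗g ∘ suc))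

Σ-zero : ∀ {k} {f : Fin k → ℤ} → (∀ i → f i ≡ 0ℤ) → Σ[ f ] ≡ 0ℤ
Σ-zero {zero}  f≡0 = refl
Σ-zero {suc k} f≡0 = cong₂ _+_ (f≡0 zero) (Σ-zero (f≡0 ∘ suc))

Σ-+ : ∀ {k} (f g : Fin k → ℤ) → Σ[ (λ i → f i + g i) ] ≡ Σ[ f ] + Σ[ g ]
Σ-+ f g = begin
  Σ[ (λ i → f i + g i) ]  ≡⟨ Σ≡sum (λ i → f i + g i) ⟩
  sum (λ i → f i + g i)   ≡⟨ ∑-distrib-+ f g ⟩
  sum f + sum g           ≡⟨ cong₂ _+_ (Σ≡sum f) (Σ≡sum g) ⟨
  Σ[ f ] + Σ[ g ]         ∎
  where open ≡-Reasoning

Σ-*ˡ : ∀ {k} (c : ℤ) (f : Fin k → ℤ) → Σ[ (λ i → c * f i) ] ≡ c * Σ[ f ]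
Σ-*ˡ c f = begin
  Σ[ (λ i → c * f i) ]  ≡⟨ Σ≡sum (λ i → c * f i) ⟩
  sum (λ i → c * f i)   ≡⟨ *-distribˡ-sum c f ⟨
  c * sum f             ≡⟨ cong (c *_) (Σ≡sum f) ⟨
  c * Σ[ f ]            ∎
  where open ≡-Reasoning

Σ-*ʳ : ∀ {k} (c : ℤ) (f : Fin k → ℤ) → Σ[ (λ i → f i * c) ] ≡ Σ[ f ] * c
Σ-*ʳ c f = begin
  Σ[ (λ i → f i * c) ]  ≡⟨ Σ≡sum (λ i → f i * c) ⟩
  sum (λ i → f i * c)   ≡⟨ *-distribʳ-sum c f ⟨
  sum f * c             ≡⟨ cong (_* c) (Σ≡sum f) ⟨
  Σ[ f ] * c            ∎
  where open ≡-Reasoning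

Σ-neg : ∀ {k} (f : Fin k → ℤ) → Σ[ (λ i → - f i) ] ≡ - Σ[ f ]
Σ-neg {zero}  f = refl
Σ-neg {suc k} f = trans (cong (_+_ (- f zero)) (Σ-neg (f ∘ suc))) (sym (ℤP.neg-distrib-+ (f zero) _))

Σ-- : ∀ {k} (f g : Fin k → ℤ) → Σ[ (λ i → f i - g i) ] ≡ Σ[ f ] - Σ[ g ]
Σ-- f g = trans (Σ-+ f (-_ ∘ g)) (cong (_+_ Σ[ f ]) (Σ-neg g))

Σ-swap : ∀ {k l} (f : Fin k → Fin l → ℤ) →
         Σ[ (λ i → Σ[ f i ]) ] ≡ Σ[ (λ j → Σ[ (λ i → f i j) ]) ]
Σ-swap f = trans (Σ²≡sum² f) (trans (∑-comm f) (sym (Σ²≡sum² (flip f))))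

Σ-punchIn : ∀ {k} (p : Fin (suc k)) (f : Fin (suc k) → ℤ) → Σ[ f ] ≡ f p + Σ[ f ∘ punchIn p ]
Σ-punchIn p f = begin
  Σ[ f ]                     ≡⟨ Σ≡sum f ⟩
  sum f                      ≡⟨ sum-remove {i = p} f ⟩
  f p + sum (f ∘ punchIn p)  ≡⟨ cong (_+_ (f p)) (Σ≡sum (f ∘ punchIn p)) ⟨
  f p + Σ[ f ∘ punchIn p ]   ∎
  where open ≡-Reasoning

Σ-init-last : ∀ {k} (f : Fin (suc k) → ℤ) → Σ[ f ] ≡ Σ[ f ∘ inject₁ ] + f (fromℕ k)
Σ-init-last {k} f = begin
  Σ[ f ]                          ≡⟨ Σ≡sum f ⟩
  sum f                           ≡⟨ sum-init-last f ⟩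
  sum (f ∘ inject₁) + f (fromℕ k) ≡⟨ cong (_+ f (fromℕ k)) (Σ≡sum (f ∘ inject₁)) ⟨
  Σ[ f ∘ inject₁ ] + f (fromℕ k)  ∎
  where open ≡-Reasoning

insertAt-punchOut : ∀ {A : Set} {k} (g : Fin k → A) {a b : Fin (suc k)} (a≢b : a ≢ b) v →
                    insertAt g a v b ≡ g (punchOut a≢b)
insertAt-punchOut g {a} a≢b v = begin
  insertAt g a v _                            ≡⟨ cong (insertAt g a v) (punchIn-punchOut a≢b) ⟨
  insertAt g a v (punchIn a (punchOut a≢b))   ≡⟨ insertAt-punchIn g a v _ ⟩
  g (punchOut a≢b)                            ∎
  where open ≡-Reasoning

Σ-insertAt-0 : ∀ {k} (g : Fin k → ℤ) (a : Fin (suc k)) → Σ[ insertAt g a 0ℤ ] ≡ Σ[ g ]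
Σ-insertAt-0 g a = trans (Σ-punchIn a (insertAt g a 0ℤ))
  (trans (cong₂ _+_ (insertAt-lookup g a 0ℤ) (Σ-cong (insertAt-punchIn g a 0ℤ))) (ℤP.+-identityˡ _))

δ : ∀ {k} → Fin k → Fin k → ℤ
δ i j with i ≟ j
... | yes _ = 1ℤ
... | no  _ = 0ℤ

δ-refl : ∀ {k} (i : Fin k) → δ i i ≡ 1ℤ
δ-refl i with i ≟ i
... | yes _   = refl
... | no  i≢i = ⊥-elim (i≢i refl)

δ-≢ : ∀ {k} {i j : Fin k} → i ≢ j → δ i j ≡ 0ℤ
δ-≢ {i = i} {j} i≢j with i ≟ j
... | yes i≡j = ⊥-elim (i≢j i≡j)
... | no  _   = refl

δ-sym : ∀ {k} (i j : Fin k) → δ i j ≡ δ j i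
δ-sym i j with i ≟ j | j ≟ i
... | yes _   | yes _   = refl
... | no  _   | no  _   = refl
... | yes i≡j | no  j≢i = ⊥-elim (j≢i (sym i≡j))
... | no  i≢j | yes j≡i = ⊥-elim (i≢j (sym j≡i))

Σ-δ : ∀ {k} (i : Fin k) (f : Fin k → ℤ) → Σ[ (λ j → δ i j * f j) ] ≡ f i
Σ-δ {suc k} i f = begin
  Σ[ (λ j → δ i j * f j) ]                                  ≡⟨ Σ-punchIn i (λ j → δ i j * f j) ⟩
  δ i i * f i + Σ[ (λ l → δ i (punchIn i l) * f (punchIn i l)) ]
    ≡⟨ cong₂ _+_ (cong (_* f i) (δ-refl i))
                 (Σ-zero (λ l → cong (_* f (punchIn i l)) (δ-≢ (punchInᵢ≢i i l ∘ sym)))) ⟩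
  1ℤ * f i + 0ℤ                                              ≡⟨ ℤP.+-identityʳ _ ⟩
  1ℤ * f i                                                   ≡⟨ ℤP.*-identityˡ (f i) ⟩
  f i                                                        ∎
  where open ≡-Reasoning

pos-Σℕ : ∀ {k} (f : Fin k → ℕ) → + Σℕ f ≡ Σ[ (λ i → + f i) ]
pos-Σℕ {zero}  f = refl
pos-Σℕ {suc k} f = trans (ℤP.pos-+ (f zero) (Σℕ (f ∘ suc))) (cong (_+_ (+ f zero)) (pos-Σℕ (f ∘ suc)))

Σ-nonNeg : ∀ {k} {f : Fin k → ℤ} → (∀ i → 0ℤ ≤ f i) → 0ℤ ≤ Σ[ f ]
Σ-nonNeg {zero}  0≤f = ℤ.+≤+ ℕ.z≤n
Σ-nonNeg {suc k} 0≤f = ℤP.+-mono-≤ (0≤f zero) (Σ-nonNeg (0≤f ∘ suc))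

Σ-nonNeg-≡0 : ∀ {k} {f : Fin k → ℤ} → (∀ i → 0ℤ ≤ f i) → Σ[ f ] ≡ 0ℤ → ∀ i → f i ≡ 0ℤ
Σ-nonNeg-≡0 {suc k} {f} 0≤f Σ≡0 i = ℤP.≤-antisym (subst (f i ≤_) Σ≡0 fᵢ≤Σ) (0≤f i)
  where
  0≤rest : 0ℤ ≤ Σ[ f ∘ punchIn i ]
  0≤rest = Σ-nonNeg (0≤f ∘ punchIn i)
  fᵢ≤Σ : f i ≤ Σ[ f ]
  fᵢ≤Σ = subst (f i ≤_) (sym (Σ-punchIn i f)) (ℤP.i≤i+j (f i) _ {{ℤ.nonNegative 0≤rest}})

0≤i*i : ∀ i → 0ℤ ≤ i * i
0≤i*i (+ m)    = subst (0ℤ ≤_) (ℤP.pos-* m m) (ℤ.+≤+ ℕ.z≤n)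
0≤i*i -[1+ m ] = ℤ.+≤+ ℕ.z≤n

0≤+m*i : ∀ m {i} → 0ℤ ≤ i → 0ℤ ≤ + m * i
0≤+m*i m {+ j} _ = subst (0ℤ ≤_) (ℤP.pos-* m j) (ℤ.+≤+ ℕ.z≤n)

+m*[i-j]²≡0⇒i≡j : ∀ {m i j} → m ≢ 0 → + m * ((i - j) * (i - j)) ≡ 0ℤ → i ≡ j
+m*[i-j]²≡0⇒i≡j {m} {i} {j} m≢0 eq with ℤP.i*j≡0⇒i≡0∨j≡0 (+ m) eq
... | inj₁ m≡0 = ⊥-elim (m≢0 (cong ℤ.∣_∣ m≡0))
... | inj₂ square≡0 with ℤP.i*j≡0⇒i≡0∨j≡0 (i - j) square≡0
...   | inj₁ i-j≡0 = ℤP.i-j≡0⇒i≡j i j i-j≡0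
...   | inj₂ i-j≡0 = ℤP.i-j≡0⇒i≡j i j i-j≡0

det-cong : ∀ {k} {M N : Matrix k} → (∀ i j → M i j ≡ N i j) → det M ≡ det N
det-cong {zero}  M≡N = refl
det-cong {suc k} M≡N = Σ-cong λ j →
  cong₂ (λ x y → sgn (toℕ j) * (x * y)) (M≡N zero j) (det-cong (λ r c → M≡N (suc r) (punchIn j c)))

twoRowMinor : ∀ {k} → Matrix (suc (suc k)) → Fin (suc (suc k)) → Fin (suc k) → ℤ
twoRowMinor M a l = det (λ r c → M (suc (suc r)) (punchIn a (punchIn l c)))

twoRowTerm : ∀ {k} → Matrix (suc (suc k)) → Fin (suc (suc k)) → Fin (suc k) → ℤ
twoRowTerm M a l =
  (sgn (toℕ a) * M zero a) * (sgn (toℕ l) * (M (suc zero) (punchIn a l) * twoRowMinor M a l))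

-- The inner sum runs over the columns b ≢ a of the second row, indexed through punchOut and padded
-- with 0 at b = a.
det-twoRowExpansion : ∀ {k} (M : Matrix (suc (suc k))) →
                      det M ≡ Σ[ (λ a → Σ[ insertAt (twoRowTerm M a) a 0ℤ ]) ]
det-twoRowExpansion M = Σ-cong λ a → begin
  sgn (toℕ a) * (M zero a * det (minor M zero a))
    ≡⟨ ℤP.*-assoc (sgn (toℕ a)) (M zero a) _ ⟨
  (sgn (toℕ a) * M zero a) * det (minor M zero a)
    ≡⟨ Σ-*ˡ (sgn (toℕ a) * M zero a)
            (λ l → sgn (toℕ l) * (M (suc zero) (punchIn a l) * twoRowMinor M a l)) ⟨
  Σ[ twoRowTerm M a ]
    ≡⟨ Σ-insertAt-0 (twoRowTerm M a) a ⟨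
  Σ[ insertAt (twoRowTerm M a) a 0ℤ ] ∎
  where open ≡-Reasoning

swapAdjacent : ∀ {k} → Fin k → Fin (suc k) → Fin (suc k)
swapAdjacent zero    zero          = suc zero
swapAdjacent zero    (suc zero)    = zero
swapAdjacent zero    (suc (suc i)) = suc (suc i)
swapAdjacent (suc t) zero          = zero
swapAdjacent (suc t) (suc i)       = suc (swapAdjacent t i)

punchIn-punchOut-comm : ∀ {k} {a b : Fin (suc (suc k))} (a≢b : a ≢ b) (b≢a : b ≢ a) (c : Fin k) →
                        punchIn a (punchIn (punchOut a≢b) c) ≡ punchIn b (punchIn (punchOut b≢a) c)
punchIn-punchOut-comm {_}     {zero}  {zero}  a≢b _   _       = ⊥-elim (a≢b refl)
punchIn-punchOut-comm {_}     {zero}  {suc b} _   _   _       = refl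
punchIn-punchOut-comm {_}     {suc a} {zero}  _   _   _       = refl
punchIn-punchOut-comm {suc k} {suc a} {suc b} _   _   zero    = refl
punchIn-punchOut-comm {suc k} {suc a} {suc b} a≢b b≢a (suc c) =
  cong suc (punchIn-punchOut-comm (a≢b ∘ cong suc) (b≢a ∘ cong suc) c)

sgn-punchOut : ∀ {k} {a b : Fin (suc (suc k))} (a≢b : a ≢ b) (b≢a : b ≢ a) →
               sgn (toℕ b) * sgn (toℕ (punchOut b≢a)) ≡ - (sgn (toℕ a) * sgn (toℕ (punchOut a≢b)))
sgn-punchOut {_}     {zero}     {zero}     a≢b _   = ⊥-elim (a≢b refl)
sgn-punchOut {_}     {zero}     {suc b}    _   _   = identity (sgn (toℕ b))
  where
  identity : ∀ x → - x * 1ℤ ≡ - (1ℤ * x)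
  identity = solve-∀
sgn-punchOut {_}     {suc a}    {zero}     _   _   = identity (sgn (toℕ a))
  where
  identity : ∀ x → 1ℤ * x ≡ - (- x * 1ℤ)
  identity = solve-∀
sgn-punchOut {zero}  {suc zero} {suc zero} a≢b _   = ⊥-elim (a≢b refl)
sgn-punchOut {suc k} {suc a}    {suc b}    a≢b b≢a =
  trans (neg*neg (sgn (toℕ b)) _)
    (trans (sgn-punchOut (a≢b ∘ cong suc) (b≢a ∘ cong suc)) (cong -_ (sym (neg*neg (sgn (toℕ a)) _))))
  where
  neg*neg : ∀ x y → - x * - y ≡ x * y
  neg*neg = solve-∀

twoRowTerm-antisym : ∀ {k} (M : Matrix (suc (suc k))) {a b} (a≢b : a ≢ b) (b≢a : b ≢ a) →
  twoRowTerm (M ∘ swapAdjacent zero) a (punchOut a≢b) ≡ - twoRowTerm M b (punchOut b≢a)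
twoRowTerm-antisym M {a} {b} a≢b b≢a = begin
  (sa * M₁ a) * (sp * (M₀ (punchIn a (punchOut a≢b)) * twoRowMinor M a (punchOut a≢b)))
    ≡⟨ cong₂ (λ y c → (sa * M₁ a) * (sp * (M₀ y * c))) (punchIn-punchOut a≢b)
             (det-cong (λ r c → cong (M (suc (suc r))) (punchIn-punchOut-comm a≢b b≢a c))) ⟩
  (sa * M₁ a) * (sp * (M₀ b * C))
    ≡⟨ regroup sa (M₁ a) sp (M₀ b) C ⟩
  (sa * sp) * (M₀ b * M₁ a * C)
    ≡⟨ cong (_* (M₀ b * M₁ a * C)) (sgn-punchOut b≢a a≢b) ⟩
  - (sb * sq) * (M₀ b * M₁ a * C)
    ≡⟨ regroup⁻ sb (M₀ b) sq (M₁ a) C ⟩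
  - ((sb * M₀ b) * (sq * (M₁ a * C)))
    ≡⟨ cong (λ x → - ((sb * M₀ b) * (sq * (M₁ x * C)))) (punchIn-punchOut b≢a) ⟨
  - ((sb * M₀ b) * (sq * (M₁ (punchIn b (punchOut b≢a)) * C))) ∎
  where
  open ≡-Reasoning
  M₀ M₁ : Fin _ → ℤ
  M₀ = M zero
  M₁ = M (suc zero)
  sa = sgn (toℕ a)
  sb = sgn (toℕ b)
  sp = sgn (toℕ (punchOut a≢b))
  sq = sgn (toℕ (punchOut b≢a))
  C = twoRowMinor M b (punchOut b≢a)
  regroup : ∀ s x t y c → (s * x) * (t * (y * c)) ≡ (s * t) * (y * x * c)
  regroup = solve-∀
  regroup⁻ : ∀ s x t y c → - (s * t) * (x * y * c) ≡ - ((s * x) * (t * (y * c)))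
  regroup⁻ = solve-∀

det-swap01 : ∀ {k} (M : Matrix (suc (suc k))) → det (M ∘ swapAdjacent zero) ≡ - det M
det-swap01 M = begin
  det M′                                                  ≡⟨ det-twoRowExpansion M′ ⟩
  Σ[ (λ a → Σ[ insertAt (twoRowTerm M′ a) a 0ℤ ]) ]       ≡⟨ Σ-swap (λ a → insertAt (twoRowTerm M′ a) a 0ℤ) ⟩
  Σ[ (λ b → Σ[ (λ a → insertAt (twoRowTerm M′ a) a 0ℤ b) ]) ]
    ≡⟨ Σ-cong (λ b → Σ-cong (λ a → antisym a b)) ⟩
  Σ[ (λ b → Σ[ (λ a → - insertAt (twoRowTerm M b) b 0ℤ a) ]) ]
    ≡⟨ Σ-cong (λ b → Σ-neg (insertAt (twoRowTerm M b) b 0ℤ)) ⟩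
  Σ[ (λ b → - Σ[ insertAt (twoRowTerm M b) b 0ℤ ]) ]
    ≡⟨ Σ-neg (λ b → Σ[ insertAt (twoRowTerm M b) b 0ℤ ]) ⟩
  - Σ[ (λ b → Σ[ insertAt (twoRowTerm M b) b 0ℤ ]) ]      ≡⟨ cong -_ (det-twoRowExpansion M) ⟨
  - det M                                                 ∎
  where
  open ≡-Reasoning
  M′ = M ∘ swapAdjacent zero
  antisym : ∀ a b → insertAt (twoRowTerm M′ a) a 0ℤ b ≡ - insertAt (twoRowTerm M b) b 0ℤ a
  antisym a b with a ≟ b
  ... | yes refl = trans (insertAt-lookup (twoRowTerm M′ a) a 0ℤ)
                         (cong -_ (sym (insertAt-lookup (twoRowTerm M a) a 0ℤ)))
  ... | no a≢b   = begin
    insertAt (twoRowTerm M′ a) a 0ℤ b      ≡⟨ insertAt-punchOut (twoRowTerm M′ a) a≢b 0ℤ ⟩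
    twoRowTerm M′ a (punchOut a≢b)         ≡⟨ twoRowTerm-antisym M a≢b (a≢b ∘ sym) ⟩
    - twoRowTerm M b (punchOut (a≢b ∘ sym)) ≡⟨ cong -_ (insertAt-punchOut (twoRowTerm M b) (a≢b ∘ sym) 0ℤ) ⟨
    - insertAt (twoRowTerm M b) b 0ℤ a     ∎

det-swapAdjacent : ∀ {k} (t : Fin k) (M : Matrix (suc k)) → det (M ∘ swapAdjacent t) ≡ - det M
det-swapAdjacent zero    M = det-swap01 M
det-swapAdjacent (suc t) M = begin
  Σ[ (λ j → sgn (toℕ j) * (M zero j * det (minor M zero j ∘ swapAdjacent t))) ]
    ≡⟨ Σ-cong (λ j → cong (λ d → sgn (toℕ j) * (M zero j * d)) (det-swapAdjacent t (minor M zero j))) ⟩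
  Σ[ (λ j → sgn (toℕ j) * (M zero j * - det (minor M zero j))) ]
    ≡⟨ Σ-cong (λ j → pushNeg (sgn (toℕ j)) (M zero j) (det (minor M zero j))) ⟩
  Σ[ (λ j → - (sgn (toℕ j) * (M zero j * det (minor M zero j)))) ]
    ≡⟨ Σ-neg (λ j → sgn (toℕ j) * (M zero j * det (minor M zero j))) ⟩
  - det M ∎
  where
  open ≡-Reasoning
  pushNeg : ∀ s x d → s * (x * - d) ≡ - (s * (x * d))
  pushNeg = solve-∀

rowExpansion : ∀ {k} → Matrix (suc k) → Fin (suc k) → ℤ
rowExpansion M i = Σ[ (λ j → sgn (toℕ i ℕ.+ toℕ j) * (M i j * det (minor M i j))) ]

swapAdjacent-inject₁ : ∀ {k} (t : Fin k) → swapAdjacent t (inject₁ t) ≡ suc t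
swapAdjacent-inject₁ zero    = refl
swapAdjacent-inject₁ (suc t) = cong suc (swapAdjacent-inject₁ t)

swapAdjacent-punchIn : ∀ {k} (t : Fin k) (r : Fin k) →
                       swapAdjacent t (punchIn (inject₁ t) r) ≡ punchIn (suc t) r
swapAdjacent-punchIn zero    zero    = refl
swapAdjacent-punchIn zero    (suc r) = refl
swapAdjacent-punchIn (suc t) zero    = refl
swapAdjacent-punchIn (suc t) (suc r) = cong suc (swapAdjacent-punchIn t r)

rowExpansion-swapAdjacent : ∀ {k} (t : Fin k) (M : Matrix (suc k)) →
                            rowExpansion (M ∘ swapAdjacent t) (inject₁ t) ≡ - rowExpansion M (suc t)
rowExpansion-swapAdjacent t M = trans (Σ-cong term) (Σ-neg (λ j → sgn (suc (toℕ t ℕ.+ toℕ j)) * X j))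
  where
  X : Fin _ → ℤ
  X j = M (suc t) j * det (minor M (suc t) j)
  term : ∀ j → sgn (toℕ (inject₁ t) ℕ.+ toℕ j) * (M (swapAdjacent t (inject₁ t)) j
                 * det (minor (M ∘ swapAdjacent t) (inject₁ t) j))
             ≡ - (sgn (suc (toℕ t ℕ.+ toℕ j)) * X j)
  term j = begin
    _ ≡⟨ cong₂ (λ n y → sgn (n ℕ.+ toℕ j) * (M y j * det (minor (M ∘ swapAdjacent t) (inject₁ t) j)))
               (toℕ-inject₁ t) (swapAdjacent-inject₁ t) ⟩
    _ ≡⟨ cong (λ d → sgn (toℕ t ℕ.+ toℕ j) * (M (suc t) j * d))
              (det-cong (λ r c → cong (λ y → M y (punchIn j c)) (swapAdjacent-punchIn t r))) ⟩
    sgn (toℕ t ℕ.+ toℕ j) * X j       ≡⟨ ℤP.neg-involutive _ ⟨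
    - - (sgn (toℕ t ℕ.+ toℕ j) * X j) ≡⟨ cong -_ (ℤP.neg-distribˡ-* (sgn (toℕ t ℕ.+ toℕ j)) (X j)) ⟩
    - (sgn (suc (toℕ t ℕ.+ toℕ j)) * X j) ∎
    where open ≡-Reasoning

det-rowExpansion : ∀ {k} (M : Matrix (suc k)) (i : Fin (suc k)) → det M ≡ rowExpansion M i
det-rowExpansion M i = <-weakInduction (λ i → ∀ M → det M ≡ rowExpansion M i) (λ _ → refl) expandNext i M
  where
  expandNext : ∀ t → (∀ M → det M ≡ rowExpansion M (inject₁ t)) → ∀ M → det M ≡ rowExpansion M (suc t)
  expandNext t expand M = begin
    det M                                              ≡⟨ ℤP.neg-involutive (det M) ⟨
    - - det M                                          ≡⟨ cong -_ (det-swapAdjacent t M) ⟨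
    - det (M ∘ swapAdjacent t)                         ≡⟨ cong -_ (expand (M ∘ swapAdjacent t)) ⟩
    - rowExpansion (M ∘ swapAdjacent t) (inject₁ t)   ≡⟨ cong -_ (rowExpansion-swapAdjacent t M) ⟩
    - - rowExpansion M (suc t)                         ≡⟨ ℤP.neg-involutive _ ⟩
    rowExpansion M (suc t)                             ∎
    where open ≡-Reasoning

x≡-x⇒x≡0 : ∀ x → x ≡ - x → x ≡ 0ℤ
x≡-x⇒x≡0 x x≡-x = ℤP.*-cancelˡ-≡ (+ 2) x 0ℤ (begin
  + 2 * x  ≡⟨ double x ⟩
  x + x    ≡⟨ cong (_+_ x) x≡-x ⟩
  x - x    ≡⟨ ℤP.+-inverseʳ x ⟩
  0ℤ       ∎)
  where
  open ≡-Reasoning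
  double : ∀ x → + 2 * x ≡ x + x
  double = solve-∀

mutual
  det-equalRows : ∀ {k} (M : Matrix k) {p q} → p ≢ q → M p ≗ M q → det M ≡ 0ℤ
  det-equalRows M {zero}  {zero}  p≢q Mp≗Mq = ⊥-elim (p≢q refl)
  det-equalRows M {zero}  {suc q} _   Mp≗Mq = det-equalRows-zero M q Mp≗Mq
  det-equalRows M {suc p} {zero}  _   Mp≗Mq = det-equalRows-zero M p (sym ∘ Mp≗Mq)
  det-equalRows M {suc p} {suc q} p≢q Mp≗Mq = det-equalRows-suc M (p≢q ∘ cong suc) Mp≗Mq

  det-equalRows-suc : ∀ {k} (M : Matrix (suc k)) {p q : Fin k} → p ≢ q →
                      M (suc p) ≗ M (suc q) → det M ≡ 0ℤ
  det-equalRows-suc M p≢q Mp≗Mq = Σ-zero λ j → trans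
    (cong (λ d → sgn (toℕ j) * (M zero j * d)) (det-equalRows (minor M zero j) p≢q (Mp≗Mq ∘ punchIn j)))
    (trans (cong (sgn (toℕ j) *_) (ℤP.*-zeroʳ (M zero j))) (ℤP.*-zeroʳ (sgn (toℕ j))))

  -- Swapping the first two rows either fixes M or moves the repeated row into the tail.
  det-equalRows-zero : ∀ {k} (M : Matrix (suc k)) (q : Fin k) → M zero ≗ M (suc q) → det M ≡ 0ℤ
  det-equalRows-zero M zero    M₀≗M₁ = x≡-x⇒x≡0 (det M) (trans (sym (det-cong fixed)) (det-swap01 M))
    where
    fixed : ∀ i j → M (swapAdjacent zero i) j ≡ M i j
    fixed zero          j = sym (M₀≗M₁ j)
    fixed (suc zero)    j = M₀≗M₁ j
    fixed (suc (suc i)) j = refl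
  det-equalRows-zero M (suc q) M₀≗Mq = ℤP.neg-injective (trans (sym (det-swap01 M))
    (det-equalRows-suc (M ∘ swapAdjacent zero) {zero} {suc q} (λ ()) M₀≗Mq))

replaceRow : ∀ {k} → Matrix k → Fin k → (Fin k → ℤ) → Matrix k
replaceRow M i v = updateAt M i (const v)

Σ-*adj : ∀ {k} (M : Matrix (suc k)) (i : Fin (suc k)) (v : Fin (suc k) → ℤ) →
         Σ[ (λ j → v j * adj M j i) ] ≡ det (replaceRow M i v)
Σ-*adj M i v = trans (Σ-cong term) (sym (det-rowExpansion R i))
  where
  R = replaceRow M i v
  term : ∀ j → v j * adj M j i ≡ sgn (toℕ i ℕ.+ toℕ j) * (R i j * det (minor R i j))
  term j = begin
    v j * (sgn (toℕ j ℕ.+ toℕ i) * det (minor M i j))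
      ≡⟨ x∙yz≈y∙xz (v j) (sgn (toℕ j ℕ.+ toℕ i)) (det (minor M i j)) ⟩
    sgn (toℕ j ℕ.+ toℕ i) * (v j * det (minor M i j))
      ≡⟨ cong₂ (λ n x → sgn n * (x * det (minor M i j))) (ℕP.+-comm (toℕ j) (toℕ i))
               (sym (cong (λ r → r j) (updateAt-updates i M))) ⟩
    sgn (toℕ i ℕ.+ toℕ j) * (R i j * det (minor M i j))
      ≡⟨ cong (λ d → sgn (toℕ i ℕ.+ toℕ j) * (R i j * d))
              (det-cong (λ r c → cong (λ row → row (punchIn j c))
                                      (updateAt-minimal (punchIn i r) i M (punchInᵢ≢i i r)))) ⟨
    sgn (toℕ i ℕ.+ toℕ j) * (R i j * det (minor R i j)) ∎
    where open ≡-Reasoning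

*-adj : ∀ {k} (M : Matrix (suc k)) (i i′ : Fin (suc k)) →
        Σ[ (λ j → M i j * adj M j i′) ] ≡ δ i i′ * det M
*-adj M i i′ with i ≟ i′
... | yes refl = begin
  Σ[ (λ j → M i j * adj M j i) ]  ≡⟨ Σ-*adj M i (M i) ⟩
  det (replaceRow M i (M i))      ≡⟨ det-cong (λ r c → cong (λ row → row c) (updateAt-id-local i M refl r)) ⟩
  det M                           ≡⟨ ℤP.*-identityˡ (det M) ⟨
  1ℤ * det M                      ∎
  where open ≡-Reasoning
... | no i≢i′ = trans (Σ-*adj M i′ (M i)) (det-equalRows (replaceRow M i′ (M i)) i≢i′ λ c →
  cong (λ row → row c) (trans (updateAt-minimal i i′ M i≢i′) (sym (updateAt-updates i′ M))))

adj-inverseʳ : ∀ {k} (M : Matrix k) (v : Fin k → ℤ) i → (M · (adj M · v)) i ≡ det M * v i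
adj-inverseʳ {suc k} M v i = begin
  Σ[ (λ j → M i j * Σ[ (λ l → adj M j l * v l) ]) ]
    ≡⟨ Σ-cong (λ j → Σ-*ˡ (M i j) (λ l → adj M j l * v l)) ⟨
  Σ[ (λ j → Σ[ (λ l → M i j * (adj M j l * v l)) ]) ]
    ≡⟨ Σ-swap (λ j l → M i j * (adj M j l * v l)) ⟩
  Σ[ (λ l → Σ[ (λ j → M i j * (adj M j l * v l)) ]) ]
    ≡⟨ Σ-cong (λ l → trans (Σ-cong (λ j → sym (ℤP.*-assoc (M i j) (adj M j l) (v l))))
                                 (Σ-*ʳ (v l) (λ j → M i j * adj M j l))) ⟩
  Σ[ (λ l → Σ[ (λ j → M i j * adj M j l) ] * v l) ]
    ≡⟨ Σ-cong (λ l → cong (_* v l) (*-adj M i l)) ⟩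
  Σ[ (λ l → δ i l * det M * v l) ]
    ≡⟨ Σ-cong (λ l → ℤP.*-assoc (δ i l) (det M) (v l)) ⟩
  Σ[ (λ l → δ i l * (det M * v l)) ]
    ≡⟨ Σ-δ i (λ l → det M * v l) ⟩
  det M * v i ∎
  where open ≡-Reasoning

·-- : ∀ {k} (M : Matrix k) (f g : Fin k → ℤ) i → (M · (λ j → f j - g j)) i ≡ (M · f) i - (M · g) i
·-- M f g i =
  trans (Σ-cong (λ j → x[y-z]≈xy-xz (M i j) (f j) (g j))) (Σ-- (λ j → M i j * f j) (λ j → M i j * g j))

·-*ˡ : ∀ {k} (M : Matrix k) (c : ℤ) (f : Fin k → ℤ) i → (M · (λ j → c * f j)) i ≡ c * (M · f) i
·-*ˡ M c f i = trans (Σ-cong (λ j → x∙yz≈y∙xz (M i j) c (f j))) (Σ-*ˡ c (λ j → M i j * f j))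

quadForm : ∀ {k} → Matrix k → (Fin k → ℤ) → ℤ
quadForm M x = Σ[ (λ i → x i * (M · x) i) ]

TrivialKernel : ∀ {k} → Matrix k → Set
TrivialKernel M = ∀ x → (∀ i → (M · x) i ≡ 0ℤ) → ∀ i → x i ≡ 0ℤ

record PositiveDefinite {k} (M : Matrix k) : Set where
  field
    nonNegative : ∀ x → 0ℤ ≤ quadForm M x
    definite    : ∀ x → quadForm M x ≡ 0ℤ → ∀ i → x i ≡ 0ℤ

  trivialKernel : TrivialKernel M
  trivialKernel x Mx≡0 = definite x (Σ-zero λ i → trans (cong (x i *_) (Mx≡0 i)) (ℤP.*-zeroʳ (x i)))

open PositiveDefinite

quadForm-minor : ∀ {k} (M : Matrix (suc k)) x → quadForm M (0ℤ ∷ x) ≡ quadForm (minor M zero zero) x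
quadForm-minor M x = trans (ℤP.+-identityˡ _) (Σ-cong λ i → cong (x i *_) (trans
  (cong (_+ Σ[ (λ j → M (suc i) (suc j) * x j) ]) (ℤP.*-zeroʳ (M (suc i) zero)))
  (ℤP.+-identityˡ _)))

PositiveDefinite-minor : ∀ {k} {M : Matrix (suc k)} →
                         PositiveDefinite M → PositiveDefinite (minor M zero zero)
PositiveDefinite-minor {M = M} pd = record
  { nonNegative = λ x → subst (0ℤ ≤_) (quadForm-minor M x) (nonNegative pd (0ℤ ∷ x))
  ; definite    = λ x q≡0 i → definite pd (0ℤ ∷ x) (trans (quadForm-minor M x) q≡0) (suc i)
  }

0<i*j⇒0<j : ∀ i j → 0ℤ < i → 0ℤ < i * j → 0ℤ < j
0<i*j⇒0<j i@(+[1+ _ ]) j _ 0<ij = ℤP.*-cancelˡ-<-nonNeg i (subst (_< i * j) (sym (ℤP.*-zeroʳ i)) 0<ij)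
0<i*j⇒0<j (+ zero) j (ℤ.+<+ ()) _

-- The first column c of adj M satisfies M c = det M · e₀, so cᵀ M c = det(minor M 0 0) · det M,
-- and c ≠ 0 because its first entry is the (positive, by induction) leading principal minor.
det-pos : ∀ {k} {M : Matrix k} → PositiveDefinite M → 0ℤ < det M
det-pos {zero}          _  = ℤ.+<+ (ℕ.s≤s ℕ.z≤n)
det-pos {suc k} {M = M} pd = 0<i*j⇒0<j (det M₀₀) (det M) 0<detM₀₀ (subst (0ℤ <_) quadForm-c 0<quadForm-c)
  where
  M₀₀ = minor M zero zero
  0<detM₀₀ = det-pos (PositiveDefinite-minor pd)
  c : Fin (suc k) → ℤ
  c i = adj M i zero
  c₀ : c zero ≡ det M₀₀
  c₀ = ℤP.*-identityˡ _
  quadForm-c : quadForm M c ≡ det M₀₀ * det M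
  quadForm-c = begin
    Σ[ (λ i → c i * Σ[ (λ j → M i j * adj M j zero) ]) ]
      ≡⟨ Σ-cong (λ i → cong (c i *_) (*-adj M i zero)) ⟩
    Σ[ (λ i → c i * (δ i zero * det M)) ]
      ≡⟨ Σ-cong (λ i → trans (x∙yz≈y∙xz (c i) (δ i zero) (det M)) (cong (_* (c i * det M)) (δ-sym i zero))) ⟩
    Σ[ (λ i → δ zero i * (c i * det M)) ]
      ≡⟨ Σ-δ zero (λ i → c i * det M) ⟩
    c zero * det M
      ≡⟨ cong (_* det M) c₀ ⟩
    det M₀₀ * det M ∎
    where open ≡-Reasoning
  0<quadForm-c : 0ℤ < quadForm M c
  0<quadForm-c = ℤP.≤∧≢⇒< (nonNegative pd c)
                   (λ 0≡q → ℤP.<⇒≢ 0<detM₀₀ (sym (trans (sym c₀) (definite pd c (sym 0≡q) zero))))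

adj-inverseˡ : ∀ {k} {M : Matrix k} → TrivialKernel M → ∀ v i → (adj M · (M · v)) i ≡ det M * v i
adj-inverseˡ {M = M} ker v i = ℤP.i-j≡0⇒i≡j _ _ (ker y My≡0 i)
  where
  y = λ i → (adj M · (M · v)) i - det M * v i
  My≡0 : ∀ i → (M · y) i ≡ 0ℤ
  My≡0 i = begin
    (M · y) i
      ≡⟨ ·-- M (adj M · (M · v)) (λ j → det M * v j) i ⟩
    (M · (adj M · (M · v))) i - (M · (λ j → det M * v j)) i
      ≡⟨ cong₂ _-_ (adj-inverseʳ M (M · v) i) (·-*ˡ M (det M) v i) ⟩
    det M * (M · v) i - det M * (M · v) i
      ≡⟨ ℤP.+-inverseʳ (det M * (M · v) i) ⟩
    0ℤ ∎
    where open ≡-Reasoning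

InImage : ∀ {k} → Matrix k → (Fin k → ℤ) → Set
InImage M d = ∃ λ u → ∀ i → (M · u) i ≡ d i

adj·-divisible⇒InImage : ∀ {k} (M : Matrix k) → det M ≢ 0ℤ → ∀ d →
                          (∀ i → det M ∣ (adj M · d) i) → InImage M d
adj·-divisible⇒InImage M det≢0 d det∣adj·d = u , Mu≡d
  where
  instance _ = ℤ.≢-nonZero det≢0
  det∣ˢadj·d : ∀ i → det M Signed.∣ (adj M · d) i
  det∣ˢadj·d i = Signed.∣ᵤ⇒∣ {det M} {(adj M · d) i} (det∣adj·d i)
  u : _ → ℤ
  u i = Signed.quotient (det∣ˢadj·d i)
  det*u≡adj·d : ∀ i → det M * u i ≡ (adj M · d) i
  det*u≡adj·d i = trans (ℤP.*-comm (det M) (u i)) (sym (Signed._∣_.equality (det∣ˢadj·d i)))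
  Mu≡d : ∀ i → (M · u) i ≡ d i
  Mu≡d i = ℤP.*-cancelˡ-≡ (det M) _ _ (begin
    det M * (M · u) i            ≡⟨ ·-*ˡ M (det M) u i ⟨
    (M · (λ j → det M * u j)) i  ≡⟨ Σ-cong (λ j → cong (M i j *_) (det*u≡adj·d j)) ⟩
    (M · (adj M · d)) i          ≡⟨ adj-inverseʳ M d i ⟩
    det M * d i                  ∎)
    where open ≡-Reasoning

InImage⇒adj·-divisible : ∀ {k} {M : Matrix k} → TrivialKernel M → ∀ {d} → InImage M d →
                          ∀ i → det M ∣ (adj M · d) i
InImage⇒adj·-divisible {M = M} ker {d} (u , Mu≡d) i = Signed.∣⇒∣ᵤ (Signed.divides (u i) (begin
  (adj M · d) i          ≡⟨ Σ-cong (λ j → cong (adj M i j *_) (Mu≡d j)) ⟨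
  (adj M · (M · u)) i    ≡⟨ adj-inverseˡ ker u i ⟩
  det M * u i            ≡⟨ ℤP.*-comm (det M) (u i) ⟩
  u i * det M            ∎))
  where open ≡-Reasoning

punchIn-fromℕ : ∀ {k} (i : Fin k) → punchIn (fromℕ k) i ≡ inject₁ i
punchIn-fromℕ zero    = refl
punchIn-fromℕ (suc i) = cong suc (punchIn-fromℕ i)

inject₁-or-fromℕ : ∀ {k} (r : Fin (suc k)) → (∃ λ i → r ≡ inject₁ i) ⊎ r ≡ fromℕ k
inject₁-or-fromℕ {zero}  zero    = inj₂ refl
inject₁-or-fromℕ {suc k} zero    = inj₁ (zero , refl)
inject₁-or-fromℕ {suc k} (suc r) with inject₁-or-fromℕ r
... | inj₁ (i , r≡i) = inj₁ (suc i , cong suc r≡i)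
... | inj₂ r≡last    = inj₂ (cong suc r≡last)

init-≗∧Σ-≡⇒≗ : ∀ {k} (x y : Fin (suc k) → ℤ) →
               (∀ i → x (inject₁ i) ≡ y (inject₁ i)) → Σ[ x ] ≡ Σ[ y ] → x ≗ y
init-≗∧Σ-≡⇒≗ {k} x y init≗ Σ≡ r with inject₁-or-fromℕ r
... | inj₁ (i , refl) = init≗ i
... | inj₂ refl       = +-cancelˡ Σ[ y ∘ inject₁ ] (x (fromℕ k)) (y (fromℕ k)) (begin
  Σ[ y ∘ inject₁ ] + x (fromℕ k)  ≡⟨ cong (_+ x (fromℕ k)) (Σ-cong init≗) ⟨
  Σ[ x ∘ inject₁ ] + x (fromℕ k)  ≡⟨ Σ-init-last x ⟨
  Σ[ x ]                          ≡⟨ Σ≡ ⟩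
  Σ[ y ]                          ≡⟨ Σ-init-last y ⟩
  Σ[ y ∘ inject₁ ] + y (fromℕ k)  ∎)
  where open ≡-Reasoning

padLast : ∀ {k} → (Fin k → ℤ) → Fin (suc k) → ℤ
padLast {k} u = insertAt u (fromℕ k) 0ℤ

padLast-inject₁ : ∀ {k} (u : Fin k → ℤ) i → padLast u (inject₁ i) ≡ u i
padLast-inject₁ {k} u i =
  trans (cong (padLast u) (sym (punchIn-fromℕ i))) (insertAt-punchIn u (fromℕ k) 0ℤ i)

padLast-last : ∀ {k} (u : Fin k → ℤ) → padLast u (fromℕ k) ≡ 0ℤ
padLast-last {k} u = insertAt-lookup u (fromℕ k) 0ℤ

module _ {n : ℕ} (G : Multigraph n) where

  laplacian-δ : ∀ i j → laplacian G i j ≡ δ i j * + valency G i - + A G i j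
  laplacian-δ i j with i ≟ j
  ... | yes _ = cong (_- + A G i j) (sym (ℤP.*-identityˡ (+ valency G i)))
  ... | no  _ = sym (ℤP.+-identityˡ _)

  laplacian-sym : ∀ i j → laplacian G i j ≡ laplacian G j i
  laplacian-sym i j with i ≟ j | j ≟ i
  ... | yes refl | yes _    = refl
  ... | yes refl | no  i≢i  = ⊥-elim (i≢i refl)
  ... | no  i≢i  | yes refl = ⊥-elim (i≢i refl)
  ... | no  _    | no  _    = cong (-_ ∘ +_) (symmetric G i j)

  laplacian-rowSum : ∀ i → Σ[ laplacian G i ] ≡ 0ℤ
  laplacian-rowSum i = begin
    Σ[ laplacian G i ]
      ≡⟨ Σ-cong (laplacian-δ i) ⟩
    Σ[ (λ j → δ i j * + valency G i - + A G i j) ]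
      ≡⟨ Σ-- (λ j → δ i j * + valency G i) (λ j → + A G i j) ⟩
    Σ[ (λ j → δ i j * + valency G i) ] - Σ[ (λ j → + A G i j) ]
      ≡⟨ cong₂ _-_ (Σ-δ i (const (+ valency G i))) (sym (pos-Σℕ (A G i))) ⟩
    + valency G i - + valency G i
      ≡⟨ ℤP.+-inverseʳ (+ valency G i) ⟩
    0ℤ ∎
    where open ≡-Reasoning

  laplacian·-sub-const : ∀ σ c i → (laplacian G · (λ j → σ j - c)) i ≡ (laplacian G · σ) i
  laplacian·-sub-const σ c i = begin
    (laplacian G · (λ j → σ j - c)) i       ≡⟨ ·-- (laplacian G) σ (const c) i ⟩
    Lσᵢ - Σ[ (λ j → laplacian G i j * c) ]  ≡⟨ cong (_-_ Lσᵢ) (Σ-*ʳ c (laplacian G i)) ⟩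
    Lσᵢ - Σ[ laplacian G i ] * c            ≡⟨ cong (λ s → Lσᵢ - s * c) (laplacian-rowSum i) ⟩
    Lσᵢ - 0ℤ                                ≡⟨ ℤP.+-identityʳ Lσᵢ ⟩
    Lσᵢ                                     ∎
    where
    open ≡-Reasoning
    Lσᵢ = (laplacian G · σ) i

  Σ-laplacian· : ∀ σ → Σ[ laplacian G · σ ] ≡ 0ℤ
  Σ-laplacian· σ = begin
    Σ[ (λ i → Σ[ (λ j → laplacian G i j * σ j) ]) ]  ≡⟨ Σ-swap (λ i j → laplacian G i j * σ j) ⟩
    Σ[ (λ j → Σ[ (λ i → laplacian G i j * σ j) ]) ]  ≡⟨ Σ-cong (λ j → Σ-*ʳ (σ j) (λ i → laplacian G i j)) ⟩
    Σ[ (λ j → Σ[ (λ i → laplacian G i j) ] * σ j) ]  ≡⟨ Σ-zero (λ j → cong (_* σ j) columnSum) ⟩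
    0ℤ                                               ∎
    where
    open ≡-Reasoning
    columnSum : ∀ {j} → Σ[ (λ i → laplacian G i j) ] ≡ 0ℤ
    columnSum {j} = trans (Σ-cong (λ i → laplacian-sym i j)) (laplacian-rowSum j)

  laplacian-quadFormTerm : ∀ σ i → σ i * (laplacian G · σ) i ≡
                           Σ[ (λ j → + A G i j * (σ i * σ i) - + A G i j * (σ i * σ j)) ]
  laplacian-quadFormTerm σ i = begin
    σ i * Σ[ (λ j → laplacian G i j * σ j) ]
      ≡⟨ Σ-*ˡ (σ i) (λ j → laplacian G i j * σ j) ⟨
    Σ[ (λ j → σ i * (laplacian G i j * σ j)) ]
      ≡⟨ Σ-cong (λ j → trans (cong (λ l → σ i * (l * σ j)) (laplacian-δ i j))
                             (distribute (σ i) (δ i j) _ (a j) (σ j))) ⟩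
    Σ[ (λ j → δ i j * (σ i * + valency G i * σ j) - Q j) ]
      ≡⟨ Σ-- (λ j → δ i j * (σ i * + valency G i * σ j)) Q ⟩
    Σ[ (λ j → δ i j * (σ i * + valency G i * σ j)) ] - Σ[ Q ]
      ≡⟨ cong (_- Σ[ Q ]) (Σ-δ i (λ j → σ i * + valency G i * σ j)) ⟩
    σ i * + valency G i * σ i - Σ[ Q ]
      ≡⟨ cong (_- Σ[ Q ]) (trans (square (σ i) (+ valency G i)) (cong (_* (σ i * σ i)) (pos-Σℕ (A G i)))) ⟩
    Σ[ a ] * (σ i * σ i) - Σ[ Q ]
      ≡⟨ cong (_- Σ[ Q ]) (Σ-*ʳ (σ i * σ i) a) ⟨
    Σ[ P ] - Σ[ Q ]
      ≡⟨ Σ-- P Q ⟨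
    Σ[ (λ j → P j - Q j) ] ∎
    where
    open ≡-Reasoning
    a P Q : Fin n → ℤ
    a j = + A G i j
    P j = a j * (σ i * σ i)
    Q j = a j * (σ i * σ j)
    distribute : ∀ s d v b t → s * ((d * v - b) * t) ≡ d * (s * v * t) - b * (s * t)
    distribute = solve-∀
    square : ∀ s v → s * v * s ≡ v * (s * s)
    square = solve-∀

  edgeEnergy : (Fin n → ℤ) → Fin n → Fin n → ℤ
  edgeEnergy σ i j = + A G i j * ((σ i - σ j) * (σ i - σ j))

  -- Expanding the squares, the cross terms make up 2σᵀLσ and the two families of square terms
  -- cancel by the symmetry of A.
  laplacian-energy : ∀ σ → + 2 * quadForm (laplacian G) σ ≡ Σ[ (λ i → Σ[ edgeEnergy σ i ]) ]
  laplacian-energy σ = sym (begin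
    Σ[ (λ i → Σ[ edgeEnergy σ i ]) ]
      ≡⟨ Σ-cong (λ i → trans (Σ-cong (λ j → expandSquare (a i j) (σ i) (σ j)))
                             (Σ-+ (λ j → + 2 * (P i j - Q i j)) (λ j → Z i j - P i j))) ⟩
    Σ[ (λ i → Σ[ (λ j → + 2 * (P i j - Q i j)) ] + Σ[ (λ j → Z i j - P i j) ]) ]
      ≡⟨ Σ-+ (λ i → Σ[ (λ j → + 2 * (P i j - Q i j)) ]) (λ i → Σ[ (λ j → Z i j - P i j) ]) ⟩
    Σ[ (λ i → Σ[ (λ j → + 2 * (P i j - Q i j)) ]) ] + Σ[ (λ i → Σ[ (λ j → Z i j - P i j) ]) ]
      ≡⟨ cong₂ _+_ crossTerms squareTerms ⟩
    + 2 * quadForm (laplacian G) σ + 0ℤ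
      ≡⟨ ℤP.+-identityʳ _ ⟩
    + 2 * quadForm (laplacian G) σ ∎)
    where
    open ≡-Reasoning
    a P Q Z : Fin n → Fin n → ℤ
    a i j = + A G i j
    P i j = a i j * (σ i * σ i)
    Q i j = a i j * (σ i * σ j)
    Z i j = a i j * (σ j * σ j)

    expandSquare : ∀ a x y → a * ((x - y) * (x - y)) ≡
                             + 2 * (a * (x * x) - a * (x * y)) + (a * (y * y) - a * (x * x))
    expandSquare = solve-∀

    crossTerms : Σ[ (λ i → Σ[ (λ j → + 2 * (P i j - Q i j)) ]) ] ≡ + 2 * quadForm (laplacian G) σ
    crossTerms = begin
      Σ[ (λ i → Σ[ (λ j → + 2 * (P i j - Q i j)) ]) ]
        ≡⟨ Σ-cong (λ i → trans (Σ-*ˡ (+ 2) (λ j → P i j - Q i j))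
                               (cong (+ 2 *_) (sym (laplacian-quadFormTerm σ i)))) ⟩
      Σ[ (λ i → + 2 * (σ i * (laplacian G · σ) i)) ]
        ≡⟨ Σ-*ˡ (+ 2) (λ i → σ i * (laplacian G · σ) i) ⟩
      + 2 * quadForm (laplacian G) σ ∎

    squareTerms : Σ[ (λ i → Σ[ (λ j → Z i j - P i j) ]) ] ≡ 0ℤ
    squareTerms = begin
      Σ[ (λ i → Σ[ (λ j → Z i j - P i j) ]) ]
        ≡⟨ Σ-cong (λ i → Σ-- (Z i) (P i)) ⟩
      Σ[ (λ i → Σ[ Z i ] - Σ[ P i ]) ]
        ≡⟨ Σ-- (λ i → Σ[ Z i ]) (λ i → Σ[ P i ]) ⟩
      Σ[ (λ i → Σ[ Z i ]) ] - Σ[ (λ i → Σ[ P i ]) ]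
        ≡⟨ cong (_- Σ[ (λ i → Σ[ P i ]) ]) (Σ-swap Z) ⟩
      Σ[ (λ j → Σ[ (λ i → Z i j) ]) ] - Σ[ (λ i → Σ[ P i ]) ]
        ≡⟨ cong (λ s → s - Σ[ (λ i → Σ[ P i ]) ])
                (Σ-cong (λ j → Σ-cong (λ i → cong (λ m → + m * (σ j * σ j)) (symmetric G i j)))) ⟩
      Σ[ (λ j → Σ[ P j ]) ] - Σ[ (λ i → Σ[ P i ]) ]
        ≡⟨ ℤP.+-inverseʳ (Σ[ (λ i → Σ[ P i ]) ]) ⟩
      0ℤ ∎

  private
    0≤edgeEnergy : ∀ σ i j → 0ℤ ≤ edgeEnergy σ i j
    0≤edgeEnergy σ i j = 0≤+m*i (A G i j) (0≤i*i (σ i - σ j))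

    0≤Σ-edgeEnergy : ∀ σ i → 0ℤ ≤ Σ[ edgeEnergy σ i ]
    0≤Σ-edgeEnergy σ i = Σ-nonNeg (0≤edgeEnergy σ i)

  laplacian-nonNegative : ∀ σ → 0ℤ ≤ quadForm (laplacian G) σ
  laplacian-nonNegative σ = ℤP.*-cancelˡ-≤-pos 0ℤ _ (+ 2)
    (subst (0ℤ ≤_) (sym (laplacian-energy σ)) (Σ-nonNeg (0≤Σ-edgeEnergy σ)))

  laplacian-quadForm≡0⇒edge-≡ : ∀ σ → quadForm (laplacian G) σ ≡ 0ℤ → ∀ i j → A G i j ≢ 0 → σ i ≡ σ j
  laplacian-quadForm≡0⇒edge-≡ σ q≡0 i j Aᵢⱼ≢0 =
    +m*[i-j]²≡0⇒i≡j Aᵢⱼ≢0 (Σ-nonNeg-≡0 (0≤edgeEnergy σ i) (Σ-nonNeg-≡0 (0≤Σ-edgeEnergy σ) energy≡0 i) j)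
    where
    energy≡0 : Σ[ (λ i → Σ[ edgeEnergy σ i ]) ] ≡ 0ℤ
    energy≡0 = trans (sym (laplacian-energy σ)) (cong (+ 2 *_) q≡0)

  walk-≡ : ∀ (σ : Fin n → ℤ) → (∀ i j → A G i j ≢ 0 → σ i ≡ σ j) → ∀ {i j} → Walk G i j → σ i ≡ σ j
  walk-≡ σ edge-≡ here          = refl
  walk-≡ σ edge-≡ (step Aᵢⱼ≢0 w) = trans (edge-≡ _ _ Aᵢⱼ≢0) (walk-≡ σ edge-≡ w)

module _ {k : ℕ} (G : Multigraph (suc k)) where

  private
    L = laplacian G
    L̃ = reducedLaplacian G
    last = fromℕ k

  laplacian·-inject₁ : ∀ τ → τ last ≡ 0ℤ → ∀ i → (L · τ) (inject₁ i) ≡ (L̃ · (τ ∘ inject₁)) i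
  laplacian·-inject₁ τ τ-last≡0 i = begin
    (L · τ) (inject₁ i)   ≡⟨ Σ-init-last (λ j → L (inject₁ i) j * τ j) ⟩
    L̃τ̃ᵢ + Lᵢₙ * τ last    ≡⟨ cong (λ x → L̃τ̃ᵢ + Lᵢₙ * x) τ-last≡0 ⟩
    L̃τ̃ᵢ + Lᵢₙ * 0ℤ        ≡⟨ cong (_+_ L̃τ̃ᵢ) (ℤP.*-zeroʳ Lᵢₙ) ⟩
    L̃τ̃ᵢ + 0ℤ              ≡⟨ ℤP.+-identityʳ L̃τ̃ᵢ ⟩
    L̃τ̃ᵢ                   ∎
    where
    open ≡-Reasoning
    L̃τ̃ᵢ = (L̃ · (τ ∘ inject₁)) i
    Lᵢₙ = L (inject₁ i) last

  laplacian·padLast : ∀ u i → (L · padLast u) (inject₁ i) ≡ (L̃ · u) i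
  laplacian·padLast u i = trans (laplacian·-inject₁ (padLast u) (padLast-last u) i)
                                (Σ-cong (λ j → cong (L̃ i j *_) (padLast-inject₁ u j)))

  quadForm-reducedLaplacian : ∀ u → quadForm L̃ u ≡ quadForm L (padLast u)
  quadForm-reducedLaplacian u = sym (begin
    quadForm L (padLast u)
      ≡⟨ Σ-init-last (λ i → padLast u i * (L · padLast u) i) ⟩
    Σ[ (λ i → padLast u (inject₁ i) * (L · padLast u) (inject₁ i)) ] + padLast u last * (L · padLast u) last
      ≡⟨ cong₂ _+_ (Σ-cong (λ i → cong₂ _*_ (padLast-inject₁ u i) (laplacian·padLast u i)))
                   (cong (_* (L · padLast u) last) (padLast-last u)) ⟩
    quadForm L̃ u + 0ℤ
      ≡⟨ ℤP.+-identityʳ _ ⟩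
    quadForm L̃ u ∎)
    where open ≡-Reasoning

  reducedLaplacian-positiveDefinite : Connected G → PositiveDefinite L̃
  reducedLaplacian-positiveDefinite connected = record
    { nonNegative = λ u →
        subst (0ℤ ≤_) (sym (quadForm-reducedLaplacian u)) (laplacian-nonNegative G (padLast u))
    ; definite    = λ u q≡0 i → begin
        u i                   ≡⟨ padLast-inject₁ u i ⟨
        padLast u (inject₁ i) ≡⟨ walk-≡ G (padLast u) (edge-≡ u q≡0) (connected (inject₁ i) last) ⟩
        padLast u last        ≡⟨ padLast-last u ⟩
        0ℤ                    ∎
    }
    where
    open ≡-Reasoning
    edge-≡ : ∀ u → quadForm L̃ u ≡ 0ℤ → ∀ i j → A G i j ≢ 0 → padLast u i ≡ padLast u j
    edge-≡ u q≡0 = laplacian-quadForm≡0⇒edge-≡ G (padLast u) (trans (sym (quadForm-reducedLaplacian u)) q≡0)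

  ∼⇒InImage : ∀ D₁ D₂ → D₁ ∼[ G ] D₂ → InImage L̃ (λ i → reduce D₁ i - reduce D₂ i)
  ∼⇒InImage D₁ D₂ (σ , D₁-D₂≡Lσ) = u , L̃u≡d
    where
    u : Fin k → ℤ
    u i = σ (inject₁ i) - σ last
    L̃u≡d : ∀ i → (L̃ · u) i ≡ reduce D₁ i - reduce D₂ i
    L̃u≡d i = begin
      (L̃ · u) i
        ≡⟨ laplacian·-inject₁ (λ j → σ j - σ last) (ℤP.+-inverseʳ (σ last)) i ⟨
      (L · (λ j → σ j - σ last)) (inject₁ i)
        ≡⟨ laplacian·-sub-const G σ (σ last) (inject₁ i) ⟩
      (L · σ) (inject₁ i)
        ≡⟨ D₁-D₂≡Lσ (inject₁ i) ⟨
      D₁ (inject₁ i) - D₂ (inject₁ i) ∎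
      where open ≡-Reasoning

  InImage⇒∼ : ∀ D₁ D₂ → InDiv0 D₁ → InDiv0 D₂ →
              InImage L̃ (λ i → reduce D₁ i - reduce D₂ i) → D₁ ∼[ G ] D₂
  InImage⇒∼ D₁ D₂ deg₁ deg₂ (u , L̃u≡d) = padLast u ,
    init-≗∧Σ-≡⇒≗ (λ r → D₁ r - D₂ r) (L · padLast u)
      (λ i → sym (trans (laplacian·padLast u i) (L̃u≡d i)))
      (trans (Σ-- D₁ D₂) (trans (cong₂ _-_ deg₁ deg₂) (sym (Σ-laplacian· G (padLast u)))))

proposition2p4 : ∀ {k : ℕ} (G : Multigraph (suc k)) → Connected G →
    (D₁ D₂ : Divisor (suc k)) → InDiv0 D₁ → InDiv0 D₂ →
    (wTilde G D₁ ≡ wTilde G D₂ [mod jacOrder G ]) ⇔ (D₁ ∼[ G ] D₂)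
proposition2p4 G connected D₁ D₂ deg₁ deg₂ = mk⇔
  (λ w̃₁≡w̃₂ → InImage⇒∼ G D₁ D₂ deg₁ deg₂
    (adj·-divisible⇒InImage L̃ m≢0 d (λ i → subst (jacOrder G ∣_) (w̃₁-w̃₂ i) (w̃₁≡w̃₂ i))))
  (λ D₁∼D₂ i → subst (jacOrder G ∣_) (sym (w̃₁-w̃₂ i))
    (InImage⇒adj·-divisible (trivialKernel L̃-pd) (∼⇒InImage G D₁ D₂ D₁∼D₂) i))
  where
  L̃ = reducedLaplacian G
  L̃-pd = reducedLaplacian-positiveDefinite G connected
  m≢0 : jacOrder G ≢ 0ℤ
  m≢0 = ≢-sym (ℤP.<⇒≢ (det-pos L̃-pd))
  d = λ i → reduce D₁ i - reduce D₂ i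
  w̃₁-w̃₂ : ∀ i → wTilde G D₁ i - wTilde G D₂ i ≡ (adj L̃ · d) i
  w̃₁-w̃₂ i = sym (·-- (adj L̃) (reduce D₁) (reduce D₂) i)
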